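{- Let $L$ be a complete lattice and $n\ge 1$, and let $\mathscr{LM}:L^n\to L^n$ be the Lizasoain–Moreno function. Then: (i) If $(a_1,\dots,a_n)\in L^n$ is such that $a_i$ and $a_j$ are comparable for all $i\neq j$, then $\mathscr{LM}(a_1,\dots,a_n)=(a_{\sigma(1)},\dots,a_{\sigma(n)})$, where $\sigma$ is a permutation of $\{1,\dots,n\}$ such that $a_{\sigma(1)}\ge a_{\sigma(2)}\ge\dots\ge a_{\sigma(n)}$ (i.e. $(a_{\sigma(1)},\dots,a_{\sigma(n)})$ is the decreasing rearrangement of $(a_1,\dots,a_n)$). (ii) If $L$ is a linear order, then for every $(a_1,\dots,a_n)\in L^n$ there is a permutation $\sigma$ of $\{1,\dots,n\}$ such that $\mathscr{LM}(a_1,\dots,a_n)=(a_{\sigma(1)},\dots,a_{\sigma(n)})$. (iii) If $a_1\ge a_2\ge\dots\ge a_n$, then $\mathscr{LM}(a_1,\dots,a_n)=(a_1,\dots,a_n)$. (iv) $\mathscr{LM}\circ\mathscr{LM}=\mathscr{LM}$. (v) For every permutation $\sigma$ of $\{1,\dots,n\}$ and every $(a_1,\dots,a_n)\in L^n$, $\mathscr{LM}(a_{\sigma(1)},\dots,a_{\sigma(n)})=\mathscr{LM}(a_1,\dots,a_n)$.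
   Context: A complete lattice is a partially ordered set $(L,\le)$ in which every subset $S$ has a supremum $\bigvee S$ and an infimum $\bigwedge S$; $\vee,\wedge$ denote binary join and meet. The Lizasoain–Moreno function $\mathscr{LM}:L^n\to L^n$ is defined by $\mathscr{LM}(a_1,\dots,a_n)=(b_1,\dots,b_n)$ where, for $k=1,\dots,n$, $$b_k=\bigvee_{\{j_1<j_2<\dots<j_k\}\subseteq\{1,\dots,n\}} a_{j_1}\wedge a_{j_2}\wedge\dots\wedge a_{j_k},$$ the join ranging over all $k$-element subsets of $\{1,\dots,n\}$. (So $b_1=a_1\vee\dots\vee a_n$, $b_n=a_1\wedge\dots\wedge a_n$, and $b_1\ge b_2\ge\dots\ge b_n$.) -}

module Defs where

open import Level using (Level; _⊔_; suc; Lift; lift)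
open import Data.Nat using (ℕ) renaming (suc to sucℕ)
open import Data.Fin using (Fin; toℕ) renaming (_≤_ to _≤ᶠ_)
open import Data.Sum using (_⊎_)
open import Relation.Nullary using (¬_)
open import Data.Fin.Subset using (Subset; _∈_; ∣_∣)
open import Data.Product using (∃; _×_)
open import Relation.Binary.Core using (Rel)
open import Relation.Binary.Structures using (IsPartialOrder)
open import Relation.Binary.PropositionalEquality using (_≡_)
open import Relation.Unary using (Pred)

record CompleteLattice (c ℓ₁ ℓ₂ : Level) : Set (suc (c ⊔ ℓ₁ ⊔ ℓ₂)) where
  infix 4 _≈_ _≤_
  field
    Carrier        : Set c
    _≈_            : Rel Carrier ℓ₁
    _≤_            : Rel Carrier ℓ₂
    isPartialOrder : IsPartialOrder _≈_ _≤_
    ⋁              : Pred Carrier (c ⊔ ℓ₁) → Carrier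
    ⋁-upper        : ∀ (S : Pred Carrier (c ⊔ ℓ₁)) x → S x → x ≤ ⋁ S
    ⋁-least        : ∀ (S : Pred Carrier (c ⊔ ℓ₁)) y → (∀ x → S x → x ≤ y) → ⋁ S ≤ y
    ⋀              : Pred Carrier (c ⊔ ℓ₁) → Carrier
    ⋀-lower        : ∀ (S : Pred Carrier (c ⊔ ℓ₁)) x → S x → ⋀ S ≤ x
    ⋀-greatest     : ∀ (S : Pred Carrier (c ⊔ ℓ₁)) y → (∀ x → S x → y ≤ x) → y ≤ ⋀ S

module _ {c ℓ₁ ℓ₂} (L : CompleteLattice c ℓ₁ ℓ₂) where
  open CompleteLattice L

  meetOver : ∀ {n} → (Fin n → Carrier) → Subset n → Carrier
  meetOver a S = ⋀ (λ x → Lift c (∃ λ j → j ∈ S × x ≈ a j))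

  lmEntry : ∀ {n} → (Fin n → Carrier) → ℕ → Carrier
  lmEntry {n} a k = ⋁ (λ x → Lift c (∃ λ (S : Subset n) → ∣ S ∣ ≡ k × x ≈ meetOver a S))

  -- The Lizasoain–Moreno function; position i : Fin n (0-based) holds b_{i+1}.
  LM : ∀ {n} → (Fin n → Carrier) → (Fin n → Carrier)
  LM a i = lmEntry a (sucℕ (toℕ i))

  _≋_ : ∀ {n} → (Fin n → Carrier) → (Fin n → Carrier) → Set ℓ₁
  a ≋ b = ∀ i → a i ≈ b i

  Decreasing : ∀ {n} → (Fin n → Carrier) → Set ℓ₂
  Decreasing a = ∀ i j → i ≤ᶠ j → a j ≤ a i

  PairwiseComparable : ∀ {n} → (Fin n → Carrier) → Set ℓ₂
  PairwiseComparable a = ∀ i j → ¬ (i ≡ j) → (a i ≤ a j) ⊎ (a j ≤ a i)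

  IsLinear : Set (c ⊔ ℓ₂)
  IsLinear = ∀ x y → (x ≤ y) ⊎ (y ≤ x)

module Submission where

-- Everything follows from three facts.
--   • Permutation invariance (v): relabelling the entries by a permutation π maps
--     k-element index sets bijectively to k-element index sets (the preimage
--     under π has the same size), so both sides are joins of the same meets.
--   • Decreasing tuples are fixed (iii): if a₁ ≥ … ≥ aₙ, every k-element S
--     contains an index j ≥ k, so its meet is ≤ a_j ≤ a_k; and the initial
--     segment {1,…,k} attains the meet a_k.
--   • LM a is always decreasing: a (k+1)-element set contains a k-element one,
--     whose meet is larger.  With (iii) this gives idempotence (iv).
-- For (i), a pairwise comparable tuple is sorted by selection sort (put a
-- maximum first, sort the rest), and LM a = LM (a ∘ σ) = a ∘ σ by (v) and (iii)
-- for any sorting permutation σ; (ii) is the special case of a linear order.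

open import Defs
open import Level using (Level; lift)
open import Data.Nat using (ℕ; zero; suc; z≤n; s≤s; _≤_; _<_)
import Data.Nat.Properties as ℕₚ
open import Data.Fin using (Fin; toℕ; punchIn) renaming (zero to fzero; suc to fsuc)
import Data.Fin.Properties as Finₚ
open import Data.Fin.Permutation as Perm using (Permutation′; _⟨$⟩ʳ_; insert; inverseʳ; insert-punchIn)
open import Data.Fin.Subset using (Subset; _∈_; _⊆_; ∣_∣; inside; outside)
open import Data.Fin.Subset.Properties using (s⊆s; out⊆)
open import Data.Vec using ([]; _∷_; lookup; tabulate; here; there)
import Data.Vec.Properties as Vecₚ
open import Data.Bool using (true; false; if_then_else_)
open import Data.Product using (Σ; _×_; _,_; ∃)
open import Data.Sum using (inj₁; inj₂)
open import Function using (_∘_)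
open import Relation.Binary.PropositionalEquality
  using (_≡_; refl; sym; trans; cong; subst; subst₂; module ≡-Reasoning)
open import Relation.Binary.Structures using (IsPartialOrder)
import Algebra.Properties.CommutativeMonoid.Sum as CommutativeMonoidSum

open CommutativeMonoidSum ℕₚ.+-0-commutativeMonoid using (sum; sum-cong-≗; sum-permute)

private
  variable
    m n : ℕ

preimage : Subset n → (Fin m → Fin n) → Subset m
preimage S f = tabulate (λ i → lookup S (f i))

∈-preimage : (S : Subset n) (f : Fin m → Fin n) {i : Fin m} → i ∈ preimage S f → f i ∈ S
∈-preimage S f {i} i∈ =
  Vecₚ.lookup⇒[]= (f i) S (trans (sym (Vecₚ.lookup∘tabulate _ i)) (Vecₚ.[]=⇒lookup i∈))

-- The size of a subset is the sum of its indicator function; this turns the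
-- size into a sum, which is invariant under permutations of the index set.
indicator : Subset n → Fin n → ℕ
indicator S i = if lookup S i then 1 else 0

∣∣≡sum-indicator : (S : Subset n) → ∣ S ∣ ≡ sum (indicator S)
∣∣≡sum-indicator []          = refl
∣∣≡sum-indicator (true ∷ S)  = cong suc (∣∣≡sum-indicator S)
∣∣≡sum-indicator (false ∷ S) = ∣∣≡sum-indicator S

∣preimage∣ : (S : Subset n) (π : Permutation′ n) → ∣ preimage S (π ⟨$⟩ʳ_) ∣ ≡ ∣ S ∣
∣preimage∣ S π = begin
  ∣ preimage S (π ⟨$⟩ʳ_) ∣                ≡⟨ ∣∣≡sum-indicator (preimage S (π ⟨$⟩ʳ_)) ⟩
  sum (indicator (preimage S (π ⟨$⟩ʳ_))) ≡⟨ sum-cong-≗ lookup-preimage ⟩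
  sum (indicator S ∘ (π ⟨$⟩ʳ_))          ≡⟨ sym (sum-permute (indicator S) π) ⟩
  sum (indicator S)                       ≡⟨ sym (∣∣≡sum-indicator S) ⟩
  ∣ S ∣                                   ∎
  where
  open ≡-Reasoning
  lookup-preimage : ∀ i → indicator (preimage S (π ⟨$⟩ʳ_)) i ≡ indicator S (π ⟨$⟩ʳ i)
  lookup-preimage i = cong (if_then 1 else 0) (Vecₚ.lookup∘tabulate _ i)

initial : ∀ n → ℕ → Subset n
initial zero    _       = []
initial (suc n) zero    = outside ∷ initial n zero
initial (suc n) (suc k) = inside ∷ initial n k

∣initial∣ : ∀ n k → k ≤ n → ∣ initial n k ∣ ≡ k
∣initial∣ zero    zero    _         = refl
∣initial∣ (suc n) zero    _         = ∣initial∣ n zero z≤n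
∣initial∣ (suc n) (suc k) (s≤s k≤n) = cong suc (∣initial∣ n k k≤n)

∈initial : ∀ n k {j : Fin n} → j ∈ initial n k → toℕ j < k
∈initial (suc n) zero    (there j∈) with () ← ∈initial n zero j∈
∈initial (suc n) (suc k) here       = s≤s z≤n
∈initial (suc n) (suc k) (there j∈) = s≤s (∈initial n k j∈)

large-subset-reaches : (S : Subset n) (m : ℕ) → m < ∣ S ∣ → ∃ λ j → j ∈ S × m ≤ toℕ j
large-subset-reaches (true ∷ S) zero _ = fzero , here , z≤n
large-subset-reaches (true ∷ S) (suc m) (s≤s m<∣S∣)
  with j , j∈S , m≤j ← large-subset-reaches S m m<∣S∣ = fsuc j , there j∈S , s≤s m≤j
large-subset-reaches (false ∷ S) m m<∣S∣
  with j , j∈S , m≤j ← large-subset-reaches S m m<∣S∣ = fsuc j , there j∈S , ℕₚ.m≤n⇒m≤1+n m≤j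

shrink : (S : Subset n) (k : ℕ) → k ≤ ∣ S ∣ → ∃ λ T → T ⊆ S × ∣ T ∣ ≡ k
shrink [] zero _ = [] , (λ ()) , refl
shrink (true ∷ S) zero _
  with T , T⊆S , ∣T∣ ← shrink S zero z≤n = outside ∷ T , out⊆ T⊆S , ∣T∣
shrink (true ∷ S) (suc k) (s≤s k≤∣S∣)
  with T , T⊆S , ∣T∣ ← shrink S k k≤∣S∣ = inside ∷ T , s⊆s T⊆S , cong suc ∣T∣
shrink (false ∷ S) k k≤∣S∣
  with T , T⊆S , ∣T∣ ← shrink S k k≤∣S∣ = outside ∷ T , out⊆ T⊆S , ∣T∣

module _ {c ℓ₁ ℓ₂} (L : CompleteLattice c ℓ₁ ℓ₂) where
  open CompleteLattice L renaming (_≤_ to _⊑_)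
  open IsPartialOrder isPartialOrder using (module Eq; reflexive; antisym)
    renaming (refl to ⊑-refl; trans to ⊑-trans)

  meetOver-lower : (a : Fin n → Carrier) {S : Subset n} {j : Fin n} →
    j ∈ S → meetOver L a S ⊑ a j
  meetOver-lower a {j = j} j∈S = ⋀-lower _ (a j) (lift (j , j∈S , Eq.refl))

  meetOver-greatest : (a : Fin n → Carrier) (S : Subset n) (y : Carrier) →
    (∀ j → j ∈ S → y ⊑ a j) → y ⊑ meetOver L a S
  meetOver-greatest a S y y⊑ = ⋀-greatest _ y λ where
    x (lift (j , j∈S , x≈aj)) → ⊑-trans (y⊑ j j∈S) (reflexive (Eq.sym x≈aj))

  lmEntry-upper : (a : Fin n → Carrier) {k : ℕ} (S : Subset n) →
    ∣ S ∣ ≡ k → meetOver L a S ⊑ lmEntry L a k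
  lmEntry-upper a S ∣S∣≡k = ⋁-upper _ _ (lift (S , ∣S∣≡k , Eq.refl))

  lmEntry-least : (a : Fin n → Carrier) (k : ℕ) (y : Carrier) →
    (∀ S → ∣ S ∣ ≡ k → meetOver L a S ⊑ y) → lmEntry L a k ⊑ y
  lmEntry-least a k y ⊑y = ⋁-least _ y λ where
    x (lift (S , ∣S∣≡k , x≈meet)) → ⊑-trans (reflexive x≈meet) (⊑y S ∣S∣≡k)

  -- Comparison along a permutation: if a ∘ π ≤ b pointwise, then each entry of
  -- LM a is below the corresponding entry of LM b (use the preimage under π).
  lmEntry-mono-along : (a b : Fin n → Carrier) (π : Permutation′ n) →
    (∀ j → a (π ⟨$⟩ʳ j) ⊑ b j) → ∀ k → lmEntry L a k ⊑ lmEntry L b k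
  lmEntry-mono-along a b π aπ⊑b k = lmEntry-least a k _ λ S ∣S∣≡k →
    ⊑-trans (meet-preimage S) (lmEntry-upper b (preimage S _) (trans (∣preimage∣ S π) ∣S∣≡k))
    where
    meet-preimage : ∀ S → meetOver L a S ⊑ meetOver L b (preimage S (π ⟨$⟩ʳ_))
    meet-preimage S = meetOver-greatest b _ _ λ j j∈ →
      ⊑-trans (meetOver-lower a (∈-preimage S _ j∈)) (aπ⊑b j)

  LM-permute : (σ : Permutation′ n) (a : Fin n → Carrier) → _≋_ L (LM L (a ∘ (σ ⟨$⟩ʳ_))) (LM L a)
  LM-permute σ a i = antisym
    (lmEntry-mono-along (a ∘ (σ ⟨$⟩ʳ_)) a (Perm.flip σ)
      (λ _ → reflexive (Eq.reflexive (cong a (inverseʳ σ)))) _)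
    (lmEntry-mono-along a (a ∘ (σ ⟨$⟩ʳ_)) σ (λ _ → ⊑-refl) _)

  -- Larger index sets have smaller meets, so b_k is antitone in k.
  lmEntry-antitone : (a : Fin n → Carrier) {k m : ℕ} → k ≤ m → lmEntry L a m ⊑ lmEntry L a k
  lmEntry-antitone a {k} k≤m = lmEntry-least a _ _ λ S ∣S∣≡m →
    let T , T⊆S , ∣T∣≡k = shrink S k (subst (k ≤_) (sym ∣S∣≡m) k≤m)
    in ⊑-trans (meetOver-greatest a T _ (λ j j∈T → meetOver-lower a (T⊆S j∈T)))
               (lmEntry-upper a T ∣T∣≡k)

  LM-decreasing : (a : Fin n → Carrier) → Decreasing L (LM L a)
  LM-decreasing a i j i≤j = lmEntry-antitone a (s≤s i≤j)

  LM-fixes-decreasing : (a : Fin n → Carrier) → Decreasing L a → _≋_ L (LM L a) a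
  LM-fixes-decreasing {n} a a↓ i = antisym entry⊑ai ai⊑entry
    where
    k = suc (toℕ i)

    -- every k-element set contains an index j ≥ i, whose entry is ≤ a i
    entry⊑ai : lmEntry L a k ⊑ a i
    entry⊑ai = lmEntry-least a k (a i) λ S ∣S∣≡k →
      let j , j∈S , i≤j = large-subset-reaches S (toℕ i) (subst (toℕ i <_) (sym ∣S∣≡k) ℕₚ.≤-refl)
      in ⊑-trans (meetOver-lower a j∈S) (a↓ i j i≤j)

    -- the initial segment {0,…,i} has k elements and meet a i
    ai⊑entry : a i ⊑ lmEntry L a k
    ai⊑entry = ⊑-trans
      (meetOver-greatest a (initial n k) (a i) (λ j j∈ → a↓ j i (ℕₚ.≤-pred (∈initial n k j∈))))
      (lmEntry-upper a (initial n k) (∣initial∣ n k (Finₚ.toℕ<n i)))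

  LM-idempotent : (a : Fin n → Carrier) → _≋_ L (LM L (LM L a)) (LM L a)
  LM-idempotent a = LM-fixes-decreasing (LM L a) (LM-decreasing a)

  LM-sorts : (a : Fin n → Carrier) (σ : Permutation′ n) → Decreasing L (a ∘ (σ ⟨$⟩ʳ_)) →
    _≋_ L (LM L a) (a ∘ (σ ⟨$⟩ʳ_))
  LM-sorts a σ aσ↓ i = Eq.trans (Eq.sym (LM-permute σ a i)) (LM-fixes-decreasing (a ∘ (σ ⟨$⟩ʳ_)) aσ↓ i)

  maximum : (a : Fin (suc m) → Carrier) → PairwiseComparable L a → Σ (Fin (suc m)) λ p → ∀ k → a k ⊑ a p
  maximum {zero} a _ = fzero , λ { fzero → ⊑-refl }
  maximum {suc m} a comparable
    with q , aq-max ← maximum (a ∘ fsuc) (λ i j i≢j → comparable (fsuc i) (fsuc j) (i≢j ∘ Finₚ.suc-injective))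
    with comparable fzero (fsuc q) (λ ())
  ... | inj₁ a0⊑aq = fsuc q , λ { fzero → a0⊑aq ; (fsuc k) → aq-max k }
  ... | inj₂ aq⊑a0 = fzero , λ { fzero → ⊑-refl ; (fsuc k) → ⊑-trans (aq-max k) aq⊑a0 }

  -- (i), first half: selection sort.  A maximum goes first, and the remaining
  -- entries, still pairwise comparable, are sorted recursively.
  sortingPermutation : (a : Fin n → Carrier) → PairwiseComparable L a →
    Σ (Permutation′ n) λ σ → Decreasing L (a ∘ (σ ⟨$⟩ʳ_))
  sortingPermutation {zero} a _ = Perm.id , λ ()
  sortingPermutation {suc n} a comparable
    with p , ap-max ← maximum a comparable
    with τ , aτ↓ ← sortingPermutation (a ∘ punchIn p)
                     (λ i j i≢j → comparable _ _ (i≢j ∘ Finₚ.punchIn-injective p i j))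
    = σ , aσ↓
    where
    σ : Permutation′ (suc n)
    σ = insert fzero p τ

    aσ↓ : Decreasing L (a ∘ (σ ⟨$⟩ʳ_))
    aσ↓ fzero    j        _         = ap-max (σ ⟨$⟩ʳ j)
    aσ↓ (fsuc i) (fsuc j) (s≤s i≤j) =
      subst₂ (λ u v → a u ⊑ a v) (sym (insert-punchIn fzero p τ j)) (sym (insert-punchIn fzero p τ i))
        (aτ↓ i j i≤j)

proposition2 : ∀ {c ℓ₁ ℓ₂ : Level} (L : CompleteLattice c ℓ₁ ℓ₂) (n : ℕ) → 1 ≤ n →
    ((a : Fin n → CompleteLattice.Carrier L) → PairwiseComparable L a →
        Σ (Permutation′ n) (λ σ → Decreasing L (a ∘ (σ ⟨$⟩ʳ_)))
      × ((σ : Permutation′ n) → Decreasing L (a ∘ (σ ⟨$⟩ʳ_)) →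
          _≋_ L (LM L a) (a ∘ (σ ⟨$⟩ʳ_))))
    × (IsLinear L → (a : Fin n → CompleteLattice.Carrier L) →
        Σ (Permutation′ n) (λ σ → _≋_ L (LM L a) (a ∘ (σ ⟨$⟩ʳ_))))
    × ((a : Fin n → CompleteLattice.Carrier L) → Decreasing L a → _≋_ L (LM L a) a)
    × ((a : Fin n → CompleteLattice.Carrier L) → _≋_ L (LM L (LM L a)) (LM L a))
    × ((σ : Permutation′ n) (a : Fin n → CompleteLattice.Carrier L) →
        _≋_ L (LM L (a ∘ (σ ⟨$⟩ʳ_))) (LM L a))
proposition2 L n _ =
    (λ a comparable → sortingPermutation L a comparable , LM-sorts L a)
  , linear-case
  , LM-fixes-decreasing L
  , LM-idempotent L
  , LM-permute L
  where
  -- in a linear order every tuple is pairwise comparable, so (i) applies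
  linear-case : IsLinear L → (a : Fin n → CompleteLattice.Carrier L) →
    Σ (Permutation′ n) (λ σ → _≋_ L (LM L a) (a ∘ (σ ⟨$⟩ʳ_)))
  linear-case linear a =
    let σ , aσ↓ = sortingPermutation L a (λ i j _ → linear (a i) (a j))
    in σ , LM-sorts L a σ aσ↓
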